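{- Let $F$ be a maximal hke collection and let $x,y$ be two different elements of $\bigcup F$. The following are equivalent: (1) $x\approx_F y$; (2) $\{x,y\}\cap S\neq\emptyset$ for every $S\in F$; (3) $\{x,y\}\not\subseteq S$ for every $S\in F$.
   Context: A non-empty finite collection $F$ of finite sets is an \emph{hke collection} if there is a positive integer $\alpha$ such that $|\bigcup \Gamma|+|\bigcap \Gamma|=2\alpha$ for every non-empty subcollection $\Gamma\subseteq F$; it is \emph{maximal} if there is no hke collection $F'$ with $F\subsetneq F'$. The relation $\approx_F$ on $\bigcup F$ is defined by: $x\approx_F y$ iff $x=y$, or there exist $A,D\in F$ with $A-D=\{x\}$ and $D-A=\{y\}$. -}

module Defs where

open import Data.Nat using (ℕ; _+_; _*_; _≥_; _≟_)
open import Data.List using (List; []; _∷_; length; concat; filter; deduplicate)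
open import Data.List.Membership.Propositional using (_∈_; _∉_)
open import Data.List.Membership.DecPropositional _≟_ using (_∈?_)
open import Data.List.Relation.Unary.All using (All; all?)
open import Data.Product using (_×_; ∃; ∃-syntax; Σ-syntax)
open import Data.Sum using (_⊎_)
open import Relation.Nullary using (¬_)
open import Relation.Binary.PropositionalEquality using (_≡_)

-- Elements are natural numbers (an infinite ground type).
-- A finite set is represented by a list of its elements (duplicates / order irrelevant).
FSet : Set
FSet = List ℕ

Collection : Set
Collection = List FSet

_≐_ : FSet → FSet → Set
A ≐ B = ∀ z → (z ∈ A → z ∈ B) × (z ∈ B → z ∈ A)

card : FSet → ℕ
card A = length (deduplicate _≟_ A)

⋃ : Collection → FSet
⋃ Γ = concat Γ

-- Intersection of a collection (empty for the empty collection;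
-- only used for non-empty collections).
⋂ : Collection → FSet
⋂ [] = []
⋂ (A ∷ Γ) = filter (λ z → all? (λ B → z ∈? B) Γ) A

NonEmptySub : Collection → Collection → Set
NonEmptySub Γ F = ¬ (Γ ≡ []) × All (_∈ F) Γ

HKE : Collection → Set
HKE F = ¬ (F ≡ []) ×
        ∃[ α ] (α ≥ 1 × (∀ Γ → NonEmptySub Γ F → card (⋃ Γ) + card (⋂ Γ) ≡ 2 * α))

_⊊ᶜ_ : Collection → Collection → Set
F ⊊ᶜ F' = (∀ A → A ∈ F → ∃[ A' ] (A' ∈ F' × A ≐ A'))
        × ∃[ B ] (B ∈ F' × (∀ A → A ∈ F → ¬ (A ≐ B)))

MaximalHKE : Collection → Set
MaximalHKE F = HKE F × (∀ F' → HKE F' → ¬ (F ⊊ᶜ F'))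

DiffIsSingleton : FSet → FSet → ℕ → Set
DiffIsSingleton A D x = ∀ z → ((z ∈ A × z ∉ D) → z ≡ x) × (z ≡ x → (z ∈ A × z ∉ D))

_≈⟨_⟩_ : ℕ → Collection → ℕ → Set
x ≈⟨ F ⟩ y = x ≡ y ⊎ ∃[ A ] ∃[ D ] (A ∈ F × D ∈ F × DiffIsSingleton A D x × DiffIsSingleton D A y)

-- In a maximal hke collection F with constant α, two facts carry the proof.
-- (a) If every member of F contains exactly one of u, v and u ∈ A ∈ F, then
-- (A − u) ∪ {v} can be added to F keeping the hke identity: for any subcollection,
-- union and intersection change only at u and v, and these changes cancel.
-- By maximality the new set is already in F.
-- (b) No point lies in every member (otherwise exchange it for a fresh point), so
-- ⋃ F has 2α points and, for every subcollection Γ, as many points lie in all of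
-- Γ as in none of Γ. Conditioning on the members one at a time, the points lying
-- in exactly the same members as x are as many as those lying in exactly the
-- other ones; hence every x has a partner x̄ with complementary memberships.
-- (1) ⇒ (2) compares the hke identity for {A, D, S} and {A, S}; (2) ⇒ (3),
-- (3) ⇒ (2) and (2) ⇒ (1) exchange y for ȳ, ȳ for y, or x for y in a member
-- containing x̄, x, or x respectively.

module Submission where

open import Defs
open import Level using (0ℓ)
open import Data.Nat using (ℕ; suc; _+_; _*_; _≤_; _<_; _≟_)
open import Data.Bool using (if_then_else_)
open import Data.Empty using (⊥-elim)
open import Data.List using (List; []; _∷_; length; filter; deduplicate)
open import Data.List.Extrema.Nat using (max; xs≤max)
open import Data.List.Membership.DecPropositional _≟_ using (_∈?_)
open import Data.List.Membership.Propositional using (_∈_; _∉_; find; lose)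
open import Data.List.Membership.Propositional.Properties
  using (∈-deduplicate⁺; ∈-deduplicate⁻; ∈-filter⁺; ∈-filter⁻; ∈-++⁺ˡ; ∈-++⁺ʳ; ∈-++⁻; ∈-concat⁺′; ∈-concat⁻′)
open import Data.List.Membership.Propositional.Properties.WithK using (unique∧set⇒bag)
open import Data.List.Properties using (filter-≐; filter-some)
open import Data.List.Relation.Binary.BagAndSetEquality using (∼bag⇒↭)
open import Data.List.Relation.Binary.Permutation.Propositional.Properties using (↭-length)
open import Data.List.Relation.Binary.Pointwise as Pointwise using (Pointwise; []; _∷_)
open import Data.List.Relation.Unary.All as All using (All; []; _∷_; all?)
open import Data.List.Relation.Unary.AllPairs using (_∷_)
open import Data.List.Relation.Unary.Any using (here; there; any?)
open import Data.List.Relation.Unary.Unique.Propositional using (Unique)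
import Data.List.Relation.Unary.Unique.Propositional.Properties as Unique
open import Data.List.Relation.Unary.Unique.DecPropositional.Properties _≟_ using (deduplicate-!)
open import Data.Nat.Properties using (+-comm; +-suc; +-identityʳ; +-cancelʳ-≡; +-cancelˡ-≡; 1+n≢n; 1+n≰n)
open import Data.Nat.Tactic.RingSolver using (solve-∀)
open import Data.Product using (_×_; _,_; proj₁; proj₂; ∃-syntax)
open import Data.Sum using (_⊎_; inj₁; inj₂; swap; [_,_]′)
open import Data.Unit using (tt)
open import Function.Base using (id)
open import Function.Bundles using (mk⇔)
open import Relation.Binary.PropositionalEquality
  using (_≡_; _≢_; refl; sym; trans; cong; cong₂; subst; module ≡-Reasoning)
open import Relation.Nullary using (¬_; Dec; yes; no; does; ¬?; _×-dec_)
open import Relation.Nullary.Decidable using (_→-dec_)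
open import Relation.Unary using (Pred; Decidable; _⊆_)
open import Relation.Unary.Properties using (U?; _∩?_; ∁?)

open ≡-Reasoning

≐-refl : ∀ {A} → A ≐ A
≐-refl z = id , id

≐-sym : ∀ {A B} → A ≐ B → B ≐ A
≐-sym A≐B z = proj₂ (A≐B z) , proj₁ (A≐B z)

≐-trans : ∀ {A B C} → A ≐ B → B ≐ C → A ≐ C
≐-trans A≐B B≐C z = (λ p → proj₁ (B≐C z) (proj₁ (A≐B z) p)) , (λ p → proj₂ (A≐B z) (proj₂ (B≐C z) p))

≐-deduplicate : ∀ A → A ≐ deduplicate _≟_ A
≐-deduplicate A z = ∈-deduplicate⁺ _≟_ , ∈-deduplicate⁻ _≟_ A

card≡length : ∀ {A xs} → Unique xs → A ≐ xs → card A ≡ length xs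
card≡length {A} {xs} xs! A≐xs = ↭-length (∼bag⇒↭ (unique∧set⇒bag (deduplicate-! A) xs!
  (mk⇔ (proj₁ (dedupA≐xs _)) (proj₂ (dedupA≐xs _)))))
  where
  dedupA≐xs : deduplicate _≟_ A ≐ xs
  dedupA≐xs = ≐-trans (≐-sym (≐-deduplicate A)) A≐xs

card-cong : ∀ {A B} → A ≐ B → card A ≡ card B
card-cong {B = B} A≐B = card≡length (deduplicate-! B) (≐-trans A≐B (≐-deduplicate B))

card-∷ : ∀ {z A} → z ∉ A → card (z ∷ A) ≡ suc (card A)
card-∷ {z} {A} z∉A = card≡length (fresh ∷ deduplicate-! A) z∷A≐
  where
  fresh : All (z ≢_) (deduplicate _≟_ A)
  fresh = All.tabulate λ w∈ z≡w → z∉A (subst (_∈ A) (sym z≡w) (∈-deduplicate⁻ _≟_ A w∈))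
  z∷A≐ : (z ∷ A) ≐ (z ∷ deduplicate _≟_ A)
  z∷A≐ w = (λ { (here p) → here p ; (there p) → there (∈-deduplicate⁺ _≟_ p) })
         , (λ { (here p) → here p ; (there p) → there (∈-deduplicate⁻ _≟_ A p) })

infixl 6 _∖_
_∖_ : FSet → ℕ → FSet
A ∖ u = filter (λ z → ¬? (z ≟ u)) A

∈-∖⁺ : ∀ {u A z} → z ∈ A → z ≢ u → z ∈ A ∖ u
∈-∖⁺ {u} = ∈-filter⁺ (λ z → ¬? (z ≟ u))

∈-∖⁻ : ∀ {u} A {z} → z ∈ A ∖ u → z ∈ A × z ≢ u
∈-∖⁻ {u} A = ∈-filter⁻ (λ z → ¬? (z ≟ u)) {xs = A}

χ : ℕ → FSet → ℕ
χ z A = if does (z ∈? A) then 1 else 0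

χ-∈ : ∀ {z A} → z ∈ A → χ z A ≡ 1
χ-∈ {z} {A} z∈A with z ∈? A
... | yes _ = refl
... | no z∉A = ⊥-elim (z∉A z∈A)

χ-∉ : ∀ {z A} → z ∉ A → χ z A ≡ 0
χ-∉ {z} {A} z∉A with z ∈? A
... | yes z∈A = ⊥-elim (z∉A z∈A)
... | no _ = refl

χ-cong : ∀ {z A B} → (z ∈ A → z ∈ B) → (z ∈ B → z ∈ A) → χ z A ≡ χ z B
χ-cong {z} {A} {B} to from with z ∈? A
... | yes z∈A = sym (χ-∈ (to z∈A))
... | no z∉A = sym (χ-∉ (λ z∈B → z∉A (from z∈B)))

card-∖ : ∀ u A → card A ≡ χ u A + card (A ∖ u)
card-∖ u A with u ∈? A
... | yes u∈A = trans (card-cong A≐) (card-∷ (λ u∈ → proj₂ (∈-∖⁻ A u∈) refl))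
  where
  A≐ : A ≐ (u ∷ A ∖ u)
  A≐ z = (λ z∈A → case (z ≟ u) z∈A)
       , (λ { (here refl) → u∈A ; (there z∈) → proj₁ (∈-∖⁻ A z∈) })
    where
    case : Dec (z ≡ u) → z ∈ A → z ∈ u ∷ A ∖ u
    case (yes z≡u) _ = here z≡u
    case (no z≢u) z∈A = there (∈-∖⁺ z∈A z≢u)
... | no u∉A = card-cong λ z → (λ z∈A → ∈-∖⁺ z∈A λ { refl → u∉A z∈A }) , (λ z∈ → proj₁ (∈-∖⁻ A z∈))

AgreeOff : ℕ → ℕ → FSet → FSet → Set
AgreeOff u v X Z = ∀ z → z ≢ u → z ≢ v → (z ∈ X → z ∈ Z) × (z ∈ Z → z ∈ X)

card-agreeOff : ∀ {u v X Z} → u ≢ v → AgreeOff u v X Z →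
  card X + (χ u Z + χ v Z) ≡ card Z + (χ u X + χ v X)
card-agreeOff {u} {v} {X} {Z} u≢v agree = begin
  card X + (χ u Z + χ v Z)                          ≡⟨ cong (_+ (χ u Z + χ v Z)) (split X) ⟩
  χ u X + (χ v X + card (X ∖ u ∖ v)) + (χ u Z + χ v Z) ≡⟨ cong (λ k → χ u X + (χ v X + k) + (χ u Z + χ v Z)) core ⟩
  χ u X + (χ v X + card (Z ∖ u ∖ v)) + (χ u Z + χ v Z) ≡⟨ regroup (χ u X) (χ v X) (χ u Z) (χ v Z) _ ⟩
  χ u Z + (χ v Z + card (Z ∖ u ∖ v)) + (χ u X + χ v X) ≡⟨ cong (_+ (χ u X + χ v X)) (split Z) ⟨
  card Z + (χ u X + χ v X)                          ∎
  where
  regroup : ∀ a b a' b' k → a + (b + k) + (a' + b') ≡ a' + (b' + k) + (a + b)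
  regroup = solve-∀
  split : ∀ Y → card Y ≡ χ u Y + (χ v Y + card (Y ∖ u ∖ v))
  split Y = trans (card-∖ u Y) (cong (χ u Y +_) (trans (card-∖ v (Y ∖ u)) (cong (_+ card (Y ∖ u ∖ v))
    (χ-cong (λ v∈ → proj₁ (∈-∖⁻ Y v∈)) (λ v∈Y → ∈-∖⁺ v∈Y (λ v≡u → u≢v (sym v≡u)))))))
  core : card (X ∖ u ∖ v) ≡ card (Z ∖ u ∖ v)
  core = card-cong λ z → (λ z∈ → transfer z∈ λ z≢u z≢v → proj₁ (agree z z≢u z≢v))
                        , (λ z∈ → transfer z∈ λ z≢u z≢v → proj₂ (agree z z≢u z≢v))
    where
    transfer : ∀ {z Y Y'} → z ∈ Y ∖ u ∖ v → (z ≢ u → z ≢ v → z ∈ Y → z ∈ Y') → z ∈ Y' ∖ u ∖ v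
    transfer {Y = Y} z∈ f with ∈-∖⁻ (Y ∖ u) z∈
    ... | z∈Y∖u , z≢v with ∈-∖⁻ Y z∈Y∖u
    ... | z∈Y , z≢u = ∈-∖⁺ (∈-∖⁺ (f z≢u z≢v z∈Y) z≢u) z≢v

card-balance : ∀ {u v X Y Z W} → u ≢ v → AgreeOff u v X Z → AgreeOff u v Y W →
  χ u Z + χ v W ≡ χ u X + χ v Y → χ v Z + χ u W ≡ χ v X + χ u Y →
  card X + card Y ≡ card Z + card W
card-balance {u} {v} {X} {Y} {Z} {W} u≢v X~Z Y~W s t =
  +-cancelʳ-≡ (χ u Z + χ v W + (χ v Z + χ u W)) (card X + card Y) (card Z + card W) (begin
    card X + card Y + (χ u Z + χ v W + (χ v Z + χ u W))    ≡⟨ regroup (card X) (card Y) (χ u Z) (χ v Z) (χ u W) (χ v W) ⟩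
    card X + (χ u Z + χ v Z) + (card Y + (χ u W + χ v W))  ≡⟨ cong₂ _+_ (card-agreeOff u≢v X~Z) (card-agreeOff u≢v Y~W) ⟩
    card Z + (χ u X + χ v X) + (card W + (χ u Y + χ v Y))  ≡⟨ regroup (card Z) (card W) (χ u X) (χ v X) (χ u Y) (χ v Y) ⟨
    card Z + card W + (χ u X + χ v Y + (χ v X + χ u Y))    ≡⟨ cong (card Z + card W +_) (cong₂ _+_ s t) ⟨
    card Z + card W + (χ u Z + χ v W + (χ v Z + χ u W))    ∎)
  where
  regroup : ∀ x y a b c d → x + y + (a + d + (b + c)) ≡ x + (a + b) + (y + (c + d))
  regroup = solve-∀

∈-⋃⁺ : ∀ {z C Γ} → C ∈ Γ → z ∈ C → z ∈ ⋃ Γ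
∈-⋃⁺ C∈Γ z∈C = ∈-concat⁺′ z∈C C∈Γ

∈-⋃⁻ : ∀ Γ {z} → z ∈ ⋃ Γ → ∃[ C ] C ∈ Γ × z ∈ C
∈-⋃⁻ Γ z∈ = let C , z∈C , C∈Γ = ∈-concat⁻′ Γ z∈ in C , C∈Γ , z∈C

∈-⋂⁺ : ∀ {z Γ} → Γ ≢ [] → All (z ∈_) Γ → z ∈ ⋂ Γ
∈-⋂⁺ {Γ = []} Γ≢[] _ = ⊥-elim (Γ≢[] refl)
∈-⋂⁺ {Γ = C ∷ Γ} _ (z∈C ∷ z∈Γ) = ∈-filter⁺ (λ z → all? (z ∈?_) Γ) z∈C z∈Γ

∈-⋂⁻ : ∀ Γ {z} → z ∈ ⋂ Γ → All (z ∈_) Γ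
∈-⋂⁻ (C ∷ Γ) z∈ = let z∈C , z∈Γ = ∈-filter⁻ (λ z → all? (z ∈?_) Γ) {xs = C} z∈ in z∈C ∷ z∈Γ

⋃-pointwise : ∀ {z Γ Γ'} → Pointwise (λ C C' → z ∈ C → z ∈ C') Γ Γ' → z ∈ ⋃ Γ → z ∈ ⋃ Γ'
⋃-pointwise {Γ = C ∷ _} (f ∷ fs) z∈ with ∈-++⁻ C z∈
... | inj₁ z∈C = ∈-++⁺ˡ (f z∈C)
... | inj₂ z∈⋃ = ∈-++⁺ʳ _ (⋃-pointwise fs z∈⋃)

⋂-pointwise : ∀ {z Γ Γ'} → Pointwise (λ C C' → z ∈ C → z ∈ C') Γ Γ' → z ∈ ⋂ Γ → z ∈ ⋂ Γ'
⋂-pointwise {Γ = C ∷ Γ} fs@(_ ∷ _) z∈ = ∈-⋂⁺ (λ ()) (all fs (∈-⋂⁻ (C ∷ Γ) z∈))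
  where
  all : ∀ {z Δ Δ'} → Pointwise (λ C C' → z ∈ C → z ∈ C') Δ Δ' → All (z ∈_) Δ → All (z ∈_) Δ'
  all [] [] = []
  all (f ∷ fs) (z∈C ∷ z∈Δ) = f z∈C ∷ all fs z∈Δ

agreeOff-pointwise : ∀ {u v Γ Γ'} → Pointwise (AgreeOff u v) Γ Γ' →
  AgreeOff u v (⋃ Γ) (⋃ Γ') × AgreeOff u v (⋂ Γ) (⋂ Γ')
agreeOff-pointwise {u} {v} {Γ} {Γ'} Γ~Γ' =
  (λ z z≢u z≢v → ⋃-pointwise (forth z≢u z≢v) , ⋃-pointwise (back z≢u z≢v)) ,
  (λ z z≢u z≢v → ⋂-pointwise (forth z≢u z≢v) , ⋂-pointwise (back z≢u z≢v))
  where
  forth : ∀ {z} → z ≢ u → z ≢ v → Pointwise (λ C C' → z ∈ C → z ∈ C') Γ Γ'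
  forth {z} z≢u z≢v = Pointwise.map (λ agree → proj₁ (agree z z≢u z≢v)) Γ~Γ'
  back : ∀ {z} → z ≢ u → z ≢ v → Pointwise (λ C C' → z ∈ C → z ∈ C') Γ' Γ
  back {z} z≢u z≢v = Pointwise.symmetric (λ agree → proj₂ (agree z z≢u z≢v)) Γ~Γ'

Separates : ℕ → ℕ → FSet → Set
Separates u v C = (u ∈ C ⊎ v ∈ C) × ¬ (u ∈ C × v ∈ C)

separates-sym : ∀ {u v C} → Separates u v C → Separates v u C
separates-sym (u∈⊎v∈ , ¬both) = swap u∈⊎v∈ , λ (v∈ , u∈) → ¬both (u∈ , v∈)

separates-∈ : ∀ {u v C} → Separates u v C → u ∈ C → v ∉ C
separates-∈ (_ , ¬both) u∈C v∈C = ¬both (u∈C , v∈C)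

∈-other : ∀ {u v} {C : FSet} → u ∈ C ⊎ v ∈ C → u ∉ C → v ∈ C
∈-other (inj₁ u∈C) u∉C = ⊥-elim (u∉C u∈C)
∈-other (inj₂ v∈C) _ = v∈C

χ⋃+χ⋂≡1 : ∀ {u v Γ} → Γ ≢ [] → All (Separates u v) Γ → χ u (⋃ Γ) + χ v (⋂ Γ) ≡ 1
χ⋃+χ⋂≡1 {u} {v} {Γ} Γ≢[] sep = by-cases (u ∈? ⋃ Γ)
  where
  by-cases : Dec (u ∈ ⋃ Γ) → χ u (⋃ Γ) + χ v (⋂ Γ) ≡ 1
  by-cases (yes u∈) = let C , C∈Γ , u∈C = ∈-⋃⁻ Γ u∈ in
    cong₂ _+_ (χ-∈ u∈) (χ-∉ λ v∈ → proj₂ (All.lookup sep C∈Γ) (u∈C , All.lookup (∈-⋂⁻ Γ v∈) C∈Γ))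
  by-cases (no u∉) = cong₂ _+_ (χ-∉ u∉) (χ-∈ (∈-⋂⁺ Γ≢[] (All.tabulate v∈C)))
    where
    v∈C : ∀ {C} → C ∈ Γ → v ∈ C
    v∈C C∈Γ with proj₁ (All.lookup sep C∈Γ)
    ... | inj₁ u∈C = ⊥-elim (u∉ (∈-⋃⁺ C∈Γ u∈C))
    ... | inj₂ v∈C = v∈C

HKEWith : ℕ → Collection → Set
HKEWith α F = ∀ Γ → NonEmptySub Γ F → card (⋃ Γ) + card (⋂ Γ) ≡ 2 * α

exchange : ℕ → ℕ → FSet → FSet
exchange u v A = v ∷ A ∖ u

exchange-agreeOff : ∀ u v A → AgreeOff u v (exchange u v A) A
exchange-agreeOff u v A z z≢u z≢v =
  (λ { (here z≡v) → ⊥-elim (z≢v z≡v) ; (there z∈) → proj₁ (∈-∖⁻ A z∈) }) ,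
  (λ z∈A → there (∈-∖⁺ z∈A z≢u))

redirect : ∀ {B F Γ} → FSet → All (_∈ B ∷ F) Γ → Collection
redirect A [] = []
redirect A (here _ ∷ Γ⊆) = A ∷ redirect A Γ⊆
redirect A (_∷_ {x = C} (there _) Γ⊆) = C ∷ redirect A Γ⊆

redirect-⊆ : ∀ {A B F Γ} → A ∈ F → (Γ⊆ : All (_∈ B ∷ F) Γ) → All (_∈ F) (redirect A Γ⊆)
redirect-⊆ A∈F [] = []
redirect-⊆ A∈F (here _ ∷ Γ⊆) = A∈F ∷ redirect-⊆ A∈F Γ⊆
redirect-⊆ A∈F (there C∈F ∷ Γ⊆) = C∈F ∷ redirect-⊆ A∈F Γ⊆

redirect-≢[] : ∀ {A B F Γ} (Γ⊆ : All (_∈ B ∷ F) Γ) → Γ ≢ [] → redirect A Γ⊆ ≢ []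
redirect-≢[] [] Γ≢[] = Γ≢[]
redirect-≢[] (here _ ∷ _) _ ()
redirect-≢[] (there _ ∷ _) _ ()

redirect-pointwise : ∀ {R : FSet → FSet → Set} {A B F Γ} → R B A → (∀ {C} → R C C) →
  (Γ⊆ : All (_∈ B ∷ F) Γ) → Pointwise R Γ (redirect A Γ⊆)
redirect-pointwise RBA R-refl [] = []
redirect-pointwise RBA R-refl (here refl ∷ Γ⊆) = RBA ∷ redirect-pointwise RBA R-refl Γ⊆
redirect-pointwise RBA R-refl (there _ ∷ Γ⊆) = R-refl ∷ redirect-pointwise RBA R-refl Γ⊆

-- Off {u, v} the unions and intersections of Γ and of its redirection agree, and the
-- indicator corrections at u and v cancel because every member separates u and v.
exchange-extends : ∀ {α F u v A} → HKEWith α F → All (Separates u v) F → A ∈ F → u ∈ A →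
  HKEWith α (exchange u v A ∷ F)
exchange-extends {α} {F} {u} {v} {A} hke sepF A∈F u∈A Γ (Γ≢[] , Γ⊆) = begin
  card (⋃ Γ) + card (⋂ Γ)    ≡⟨ card-balance u≢v (proj₁ agree) (proj₂ agree)
                                  (trans (χ⋃+χ⋂≡1 Γ'≢[] sepΓ') (sym (χ⋃+χ⋂≡1 Γ≢[] sepΓ)))
                                  (trans (χ⋃+χ⋂≡1 Γ'≢[] (All.map separates-sym sepΓ'))
                                         (sym (χ⋃+χ⋂≡1 Γ≢[] (All.map separates-sym sepΓ)))) ⟩
  card (⋃ Γ') + card (⋂ Γ')  ≡⟨ hke Γ' (Γ'≢[] , redirect-⊆ A∈F Γ⊆) ⟩
  2 * α                      ∎
  where
  B : FSet
  B = exchange u v A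
  Γ' : Collection
  Γ' = redirect A Γ⊆
  Γ'≢[] : Γ' ≢ []
  Γ'≢[] = redirect-≢[] Γ⊆ Γ≢[]
  u≢v : u ≢ v
  u≢v refl = proj₂ (All.lookup sepF A∈F) (u∈A , u∈A)
  sepB : Separates u v B
  sepB = inj₂ (here refl) , λ where
    (here u≡v , _) → u≢v u≡v
    (there u∈A∖u , _) → proj₂ (∈-∖⁻ A u∈A∖u) refl
  sepΓ : All (Separates u v) Γ
  sepΓ = All.map (λ { (here refl) → sepB ; (there C∈F) → All.lookup sepF C∈F }) Γ⊆
  sepΓ' : All (Separates u v) Γ'
  sepΓ' = All.map (All.lookup sepF) (redirect-⊆ A∈F Γ⊆)
  agree : AgreeOff u v (⋃ Γ) (⋃ Γ') × AgreeOff u v (⋂ Γ) (⋂ Γ')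
  agree = agreeOff-pointwise (redirect-pointwise (exchange-agreeOff u v A) (λ z _ _ → id , id) Γ⊆)

count : {P : Pred ℕ 0ℓ} → Decidable P → List ℕ → ℕ
count P? xs = length (filter P? xs)

count-≐ : ∀ {P Q : Pred ℕ 0ℓ} (P? : Decidable P) (Q? : Decidable Q) → P ⊆ Q → Q ⊆ P →
  ∀ xs → count P? xs ≡ count Q? xs
count-≐ P? Q? P⊆Q Q⊆P xs = cong length (filter-≐ P? Q? (P⊆Q , Q⊆P) xs)

count-split : ∀ {P Q : Pred ℕ 0ℓ} (P? : Decidable P) (Q? : Decidable Q) xs →
  count P? xs ≡ count (P? ∩? Q?) xs + count (P? ∩? ∁? Q?) xs
count-split P? Q? [] = refl
count-split P? Q? (x ∷ xs) with P? x | Q? x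
... | yes _ | yes _ = cong suc (count-split P? Q? xs)
... | yes _ | no _ = trans (cong suc (count-split P? Q? xs)) (sym (+-suc _ _))
... | no _ | _ = count-split P? Q? xs

count+count-∁ : ∀ {P : Pred ℕ 0ℓ} (P? : Decidable P) xs → count P? xs + count (∁? P?) xs ≡ length xs
count+count-∁ P? [] = refl
count+count-∁ P? (x ∷ xs) with P? x
... | yes _ = cong suc (count+count-∁ P? xs)
... | no _ = trans (+-suc _ _) (cong suc (count+count-∁ P? xs))

count-∩-swap : ∀ {P Q R : Pred ℕ 0ℓ} (P? : Decidable P) (Q? : Decidable Q) (R? : Decidable R) xs →
  count ((P? ∩? Q?) ∩? R?) xs ≡ count ((P? ∩? R?) ∩? Q?) xs
count-∩-swap P? Q? R? = count-≐ _ _ (λ ((p , q) , r) → (p , r) , q) (λ ((p , r) , q) → (p , q) , r)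

InAll InNone : Collection → Pred ℕ 0ℓ
InAll Γ e = All (e ∈_) Γ
InNone Γ e = All (e ∉_) Γ

inAll? : ∀ Γ → Decidable (InAll Γ)
inAll? Γ e = all? (e ∈?_) Γ

inNone? : ∀ Γ → Decidable (InNone Γ)
inNone? Γ e = all? (λ C → ¬? (e ∈? C)) Γ

SameSides OppositeSides : Collection → ℕ → Pred ℕ 0ℓ
SameSides F x e = All (λ C → (x ∈ C → e ∈ C) × (x ∉ C → e ∉ C)) F
OppositeSides F x e = All (λ C → (x ∈ C → e ∉ C) × (x ∉ C → e ∈ C)) F

sameSides? : ∀ F x → Decidable (SameSides F x)
sameSides? F x e = all? (λ C → ((x ∈? C) →-dec (e ∈? C)) ×-dec (¬? (x ∈? C) →-dec ¬? (e ∈? C))) F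

oppositeSides? : ∀ F x → Decidable (OppositeSides F x)
oppositeSides? F x e = all? (λ C → ((x ∈? C) →-dec ¬? (e ∈? C)) ×-dec (¬? (x ∈? C) →-dec (e ∈? C))) F

Balanced : {P Q : Pred ℕ 0ℓ} → Decidable P → Decidable Q → Collection → List ℕ → Set
Balanced P? Q? F E = ∀ Γ → All (_∈ F) Γ → count (P? ∩? inAll? Γ) E ≡ count (Q? ∩? inNone? Γ) E

balanced-∈ : ∀ {P Q : Pred ℕ 0ℓ} (P? : Decidable P) (Q? : Decidable Q) S F E → Balanced P? Q? (S ∷ F) E →
  Balanced (P? ∩? (_∈? S)) (Q? ∩? ∁? (_∈? S)) F E
balanced-∈ P? Q? S F E bal Γ Γ⊆ = begin
  count ((P? ∩? (_∈? S)) ∩? inAll? Γ) E       ≡⟨ count-≐ _ _ (λ ((p , e∈S) , e∈Γ) → p , e∈S ∷ e∈Γ)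
                                                              (λ { (p , e∈S ∷ e∈Γ) → (p , e∈S) , e∈Γ }) E ⟩
  count (P? ∩? inAll? (S ∷ Γ)) E              ≡⟨ bal (S ∷ Γ) (here refl ∷ All.map there Γ⊆) ⟩
  count (Q? ∩? inNone? (S ∷ Γ)) E             ≡⟨ count-≐ _ _ (λ { (q , e∉S ∷ e∉Γ) → (q , e∉S) , e∉Γ })
                                                              (λ ((q , e∉S) , e∉Γ) → q , e∉S ∷ e∉Γ) E ⟩
  count ((Q? ∩? ∁? (_∈? S)) ∩? inNone? Γ) E   ∎

balanced-∉ : ∀ {P Q : Pred ℕ 0ℓ} (P? : Decidable P) (Q? : Decidable Q) S F E → Balanced P? Q? (S ∷ F) E →
  Balanced (P? ∩? ∁? (_∈? S)) (Q? ∩? (_∈? S)) F E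
balanced-∉ P? Q? S F E bal Γ Γ⊆ = begin
  count ((P? ∩? ∁? S?) ∩? inAll? Γ) E  ≡⟨ count-∩-swap P? _ _ E ⟩
  b                                   ≡⟨ +-cancelˡ-≡ a b c a+b≡a+c ⟩
  c                                   ≡⟨ count-∩-swap Q? _ _ E ⟩
  count ((Q? ∩? S?) ∩? inNone? Γ) E    ∎
  where
  S? : Decidable (_∈ S)
  S? = _∈? S
  a b c d : ℕ
  a = count ((P? ∩? inAll? Γ) ∩? S?) E
  b = count ((P? ∩? inAll? Γ) ∩? ∁? S?) E
  c = count ((Q? ∩? inNone? Γ) ∩? S?) E
  d = count ((Q? ∩? inNone? Γ) ∩? ∁? S?) E
  a≡d : a ≡ d
  a≡d = trans (count-∩-swap P? _ _ E) (trans (balanced-∈ P? Q? S F E bal Γ Γ⊆) (count-∩-swap Q? _ _ E))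
  a+b≡a+c : a + b ≡ a + c
  a+b≡a+c = begin
    a + b                       ≡⟨ count-split (P? ∩? inAll? Γ) S? E ⟨
    count (P? ∩? inAll? Γ) E    ≡⟨ bal Γ (All.map there Γ⊆) ⟩
    count (Q? ∩? inNone? Γ) E   ≡⟨ count-split (Q? ∩? inNone? Γ) S? E ⟩
    c + d                       ≡⟨ cong (c +_) (sym a≡d) ⟩
    c + a                       ≡⟨ +-comm c a ⟩
    a + c                       ∎

-- Conditioning on the side of x in the first member S turns the balance for S ∷ F
-- into a balance for F with P and Q refined by membership in S.
count-sameSides≡count-oppositeSides : ∀ {P Q : Pred ℕ 0ℓ} (P? : Decidable P) (Q? : Decidable Q) F E →
  Balanced P? Q? F E → ∀ x → count (P? ∩? sameSides? F x) E ≡ count (Q? ∩? oppositeSides? F x) E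
count-sameSides≡count-oppositeSides P? Q? [] E bal x =
  trans (count-≐ _ _ (λ (p , _) → p , []) (λ (p , _) → p , []) E)
    (trans (bal [] []) (count-≐ _ _ (λ (q , _) → q , []) (λ (q , _) → q , []) E))
count-sameSides≡count-oppositeSides P? Q? (S ∷ F) E bal x = by-side (x ∈? S)
  where
  by-side : Dec (x ∈ S) → count (P? ∩? sameSides? (S ∷ F) x) E ≡ count (Q? ∩? oppositeSides? (S ∷ F) x) E
  by-side (yes x∈S) = begin
    count (P? ∩? sameSides? (S ∷ F) x) E                ≡⟨ count-≐ _ _ peel unpeel E ⟩
    count ((P? ∩? (_∈? S)) ∩? sameSides? F x) E         ≡⟨ count-sameSides≡count-oppositeSides (P? ∩? (_∈? S)) (Q? ∩? ∁? (_∈? S)) F E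
                                                                (balanced-∈ P? Q? S F E bal) x ⟩
    count ((Q? ∩? ∁? (_∈? S)) ∩? oppositeSides? F x) E  ≡⟨ count-≐ _ _ peel unpeel E ⟨
    count (Q? ∩? oppositeSides? (S ∷ F) x) E            ∎
    where
    peel : ∀ {A : Set} {R T : FSet → Set} → A × All (λ C → (x ∈ C → R C) × (x ∉ C → T C)) (S ∷ F) →
      (A × R S) × All (λ C → (x ∈ C → R C) × (x ∉ C → T C)) F
    peel (a , (r , _) ∷ rest) = (a , r x∈S) , rest
    unpeel : ∀ {A : Set} {R T : FSet → Set} → (A × R S) × All (λ C → (x ∈ C → R C) × (x ∉ C → T C)) F →
      A × All (λ C → (x ∈ C → R C) × (x ∉ C → T C)) (S ∷ F)
    unpeel ((a , r) , rest) = a , ((λ _ → r) , (λ x∉S → ⊥-elim (x∉S x∈S))) ∷ rest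
  by-side (no x∉S) = begin
    count (P? ∩? sameSides? (S ∷ F) x) E                ≡⟨ count-≐ _ _ peel unpeel E ⟩
    count ((P? ∩? ∁? (_∈? S)) ∩? sameSides? F x) E      ≡⟨ count-sameSides≡count-oppositeSides (P? ∩? ∁? (_∈? S)) (Q? ∩? (_∈? S)) F E
                                                                (balanced-∉ P? Q? S F E bal) x ⟩
    count ((Q? ∩? (_∈? S)) ∩? oppositeSides? F x) E     ≡⟨ count-≐ _ _ peel unpeel E ⟨
    count (Q? ∩? oppositeSides? (S ∷ F) x) E            ∎
    where
    peel : ∀ {A : Set} {R T : FSet → Set} → A × All (λ C → (x ∈ C → R C) × (x ∉ C → T C)) (S ∷ F) →
      (A × T S) × All (λ C → (x ∈ C → R C) × (x ∉ C → T C)) F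
    peel (a , (_ , t) ∷ rest) = (a , t x∉S) , rest
    unpeel : ∀ {A : Set} {R T : FSet → Set} → (A × T S) × All (λ C → (x ∈ C → R C) × (x ∉ C → T C)) F →
      A × All (λ C → (x ∈ C → R C) × (x ∉ C → T C)) (S ∷ F)
    unpeel ((a , t) , rest) = a , ((λ x∈S → ⊥-elim (x∉S x∈S)) , (λ _ → t)) ∷ rest

count-positive : ∀ {P : Pred ℕ 0ℓ} (P? : Decidable P) {x xs} → x ∈ xs → P x → 0 < count P? xs
count-positive P? x∈xs px = filter-some P? (lose x∈xs px)

count-witness : ∀ {P : Pred ℕ 0ℓ} (P? : Decidable P) xs → 0 < count P? xs → ∃[ x ] x ∈ xs × P x
count-witness P? xs pos with filter P? xs in eq
count-witness P? xs () | []
... | x ∷ _ = x , ∈-filter⁻ P? (subst (x ∈_) (sym eq) (here refl))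

card≡count : ∀ {A E} → Unique E → (∀ {z} → z ∈ A → z ∈ E) → card A ≡ count (_∈? A) E
card≡count {A} {E} E! A⊆E = card≡length (Unique.filter⁺ (_∈? A) E!) λ z →
  (λ z∈A → ∈-filter⁺ (_∈? A) (A⊆E z∈A) z∈A) , (λ z∈ → proj₂ (∈-filter⁻ (_∈? A) {xs = E} z∈))

card-⋂≡count-inAll : ∀ {Γ E} → Unique E → Γ ≢ [] → (∀ {z} → z ∈ ⋂ Γ → z ∈ E) →
  card (⋂ Γ) ≡ count (inAll? Γ) E
card-⋂≡count-inAll {Γ} {E} E! Γ≢[] ⋂⊆E =
  trans (card≡count E! ⋂⊆E) (count-≐ _ _ (∈-⋂⁻ Γ) (∈-⋂⁺ Γ≢[]) E)

card-⋃+count-inNone : ∀ {Γ E} → Unique E → (∀ {z} → z ∈ ⋃ Γ → z ∈ E) →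
  card (⋃ Γ) + count (inNone? Γ) E ≡ length E
card-⋃+count-inNone {Γ} {E} E! ⋃⊆E = trans
  (cong₂ _+_ (card≡count E! ⋃⊆E) (count-≐ _ _ inNone→∉ ∉→inNone E))
  (count+count-∁ (_∈? ⋃ Γ) E)
  where
  inNone→∉ : ∀ {z} → InNone Γ z → z ∉ ⋃ Γ
  inNone→∉ z∉Γ z∈ = let C , C∈Γ , z∈C = ∈-⋃⁻ Γ z∈ in All.lookup z∉Γ C∈Γ z∈C
  ∉→inNone : ∀ {z} → z ∉ ⋃ Γ → InNone Γ z
  ∉→inNone z∉ = All.tabulate λ C∈Γ z∈C → z∉ (∈-⋃⁺ C∈Γ z∈C)

partner : ∀ {α F x} → HKEWith α F → F ≢ [] → (∀ z → z ∉ ⋂ F) → x ∈ ⋃ F →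
  ∃[ x' ] x' ∈ ⋃ F × OppositeSides F x x'
partner {α} {F} {x} hke F≢[] ⋂F-empty x∈⋃F =
  let x' , x'∈E , _ , opposite = count-witness (U? ∩? oppositeSides? F x) E
                                   (subst (0 <_) twins≡partners (count-positive _ x∈E (tt , sameSides-refl)))
  in x' , ∈-deduplicate⁻ _≟_ (⋃ F) x'∈E , opposite
  where
  E : List ℕ
  E = deduplicate _≟_ (⋃ F)
  x∈E : x ∈ E
  x∈E = ∈-deduplicate⁺ _≟_ x∈⋃F
  sameSides-refl : SameSides F x x
  sameSides-refl = All.tabulate λ _ → id , id
  ⋃⊆E : ∀ {Γ} → All (_∈ F) Γ → ∀ {z} → z ∈ ⋃ Γ → z ∈ E
  ⋃⊆E Γ⊆F z∈ = let C , C∈Γ , z∈C = ∈-⋃⁻ _ z∈ in ∈-deduplicate⁺ _≟_ (∈-⋃⁺ (All.lookup Γ⊆F C∈Γ) z∈C)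
  ∣E∣≡2α : length E ≡ 2 * α
  ∣E∣≡2α = begin
    length E                   ≡⟨ +-identityʳ (length E) ⟨
    card (⋃ F) + 0             ≡⟨ cong (card (⋃ F) +_) (card-cong {B = []} λ z → (λ z∈ → ⊥-elim (⋂F-empty z z∈)) , λ ()) ⟨
    card (⋃ F) + card (⋂ F)    ≡⟨ hke F (F≢[] , All.tabulate id) ⟩
    2 * α                      ∎
  balanced : Balanced U? U? F E
  balanced [] _ = count-≐ _ _ (λ (p , _) → p , []) (λ (p , _) → p , []) E
  balanced Γ@(_ ∷ _) Γ⊆F = begin
    count (U? ∩? inAll? Γ) E    ≡⟨ count-≐ _ _ proj₂ (tt ,_) E ⟩
    count (inAll? Γ) E          ≡⟨ card-⋂≡count-inAll E! (λ ()) (λ z∈ → ⋃⊆E Γ⊆F (∈-⋃⁺ {Γ = Γ} (here refl) (All.head (∈-⋂⁻ Γ z∈)))) ⟨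
    card (⋂ Γ)                  ≡⟨ +-cancelˡ-≡ (card (⋃ Γ)) _ _ (begin
      card (⋃ Γ) + card (⋂ Γ)           ≡⟨ hke Γ ((λ ()) , Γ⊆F) ⟩
      2 * α                             ≡⟨ ∣E∣≡2α ⟨
      length E                          ≡⟨ card-⋃+count-inNone E! (⋃⊆E Γ⊆F) ⟨
      card (⋃ Γ) + count (inNone? Γ) E  ∎) ⟩
    count (inNone? Γ) E         ≡⟨ count-≐ _ _ (tt ,_) proj₂ E ⟩
    count (U? ∩? inNone? Γ) E   ∎
    where
    E! : Unique E
    E! = deduplicate-! (⋃ F)
  twins≡partners : count (U? ∩? sameSides? F x) E ≡ count (U? ∩? oppositeSides? F x) E
  twins≡partners = count-sameSides≡count-oppositeSides U? U? F E balanced x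

EveryMeets NoneContains : Collection → ℕ → ℕ → Set
EveryMeets F x y = ∀ S → S ∈ F → x ∈ S ⊎ y ∈ S
NoneContains F x y = ∀ S → S ∈ F → ¬ (x ∈ S × y ∈ S)

-- If x, y ∉ S, adding D to {A, S} adds exactly y to the union and leaves the intersection unchanged.
≈⇒everyMeets : ∀ {α F x y} → HKEWith α F → x ≢ y → x ≈⟨ F ⟩ y → EveryMeets F x y
≈⇒everyMeets hke x≢y (inj₁ x≡y) = ⊥-elim (x≢y x≡y)
≈⇒everyMeets {α} {F} {x} {y} hke x≢y (inj₂ (A , D , A∈F , D∈F , A∖D≡x , D∖A≡y)) S S∈F with x ∈? S | y ∈? S
... | yes x∈S | _ = inj₁ x∈S
... | no _ | yes y∈S = inj₂ y∈S
... | no x∉S | no y∉S = ⊥-elim (1+n≢n (+-cancelʳ-≡ (card (⋂ Γ)) _ _ (begin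
  suc (card (⋃ Γ)) + card (⋂ Γ)    ≡⟨ cong₂ _+_ (card-∷ y∉⋃Γ) (card-cong ⋂-same) ⟨
  card (y ∷ ⋃ Γ) + card (⋂ Γ⁺)     ≡⟨ cong (_+ card (⋂ Γ⁺)) (card-cong ⋃-grows) ⟨
  card (⋃ Γ⁺) + card (⋂ Γ⁺)        ≡⟨ hke Γ⁺ ((λ ()) , A∈F ∷ D∈F ∷ S∈F ∷ []) ⟩
  2 * α                            ≡⟨ hke Γ ((λ ()) , A∈F ∷ S∈F ∷ []) ⟨
  card (⋃ Γ) + card (⋂ Γ)          ∎)))
  where
  Γ Γ⁺ : Collection
  Γ = A ∷ S ∷ []
  Γ⁺ = A ∷ D ∷ S ∷ []
  y∉A : y ∉ A
  y∉A = proj₂ (proj₂ (D∖A≡y y) refl)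
  y∉⋃Γ : y ∉ ⋃ Γ
  y∉⋃Γ y∈ with ∈-⋃⁻ Γ y∈
  ... | _ , here refl , y∈A = y∉A y∈A
  ... | _ , there (here refl) , y∈S = y∉S y∈S
  ⋃-grows : ⋃ Γ⁺ ≐ (y ∷ ⋃ Γ)
  ⋃-grows z = to , from
    where
    to : z ∈ ⋃ Γ⁺ → z ∈ y ∷ ⋃ Γ
    to z∈ with ∈-⋃⁻ Γ⁺ z∈
    ... | _ , here refl , z∈A = there (∈-⋃⁺ {Γ = Γ} (here refl) z∈A)
    ... | _ , there (there (here refl)) , z∈S = there (∈-⋃⁺ {Γ = Γ} (there (here refl)) z∈S)
    ... | _ , there (here refl) , z∈D with z ∈? A
    ...   | yes z∈A = there (∈-⋃⁺ {Γ = Γ} (here refl) z∈A)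
    ...   | no z∉A = here (proj₁ (D∖A≡y z) (z∈D , z∉A))
    from : z ∈ y ∷ ⋃ Γ → z ∈ ⋃ Γ⁺
    from (here refl) = ∈-⋃⁺ {Γ = Γ⁺} (there (here refl)) (proj₁ (proj₂ (D∖A≡y y) refl))
    from (there z∈) with ∈-⋃⁻ Γ z∈
    ... | _ , here refl , z∈A = ∈-⋃⁺ {Γ = Γ⁺} (here refl) z∈A
    ... | _ , there (here refl) , z∈S = ∈-⋃⁺ {Γ = Γ⁺} (there (there (here refl))) z∈S
  ⋂-same : ⋂ Γ⁺ ≐ ⋂ Γ
  ⋂-same z = to , from
    where
    to : z ∈ ⋂ Γ⁺ → z ∈ ⋂ Γ
    to z∈ with ∈-⋂⁻ Γ⁺ z∈
    ... | z∈A ∷ _ ∷ z∈S ∷ [] = ∈-⋂⁺ (λ ()) (z∈A ∷ z∈S ∷ [])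
    from : z ∈ ⋂ Γ → z ∈ ⋂ Γ⁺
    from z∈ with ∈-⋂⁻ Γ z∈
    ... | z∈A ∷ z∈S ∷ [] with z ∈? D
    ...   | yes z∈D = ∈-⋂⁺ (λ ()) (z∈A ∷ z∈D ∷ z∈S ∷ [])
    ...   | no z∉D = ⊥-elim (x∉S (subst (_∈ S) (proj₁ (A∖D≡x z) (z∈A , z∉D)) z∈S))

oppositeSides⇒separates : ∀ {F x x'} → OppositeSides F x x' → All (Separates x x') F
oppositeSides⇒separates = All.map λ {C} (x∈→x'∉ , x∉→x'∈) → by-cases x∈→x'∉ x∉→x'∈ (_ ∈? C)
  where
  by-cases : ∀ {x x' C} → (x ∈ C → x' ∉ C) → (x ∉ C → x' ∈ C) → Dec (x ∈ C) → Separates x x' C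
  by-cases x∈→x'∉ _ (yes x∈C) = inj₁ x∈C , λ (x∈C , x'∈C) → x∈→x'∉ x∈C x'∈C
  by-cases _ x∉→x'∈ (no x∉C) = inj₂ (x∉→x'∈ x∉C) , λ (x∈C , _) → x∉C x∈C

_≐?_ : ∀ A B → Dec (A ≐ B)
A ≐? B with all? (_∈? B) A | all? (_∈? A) B
... | yes A⊆B | yes B⊆A = yes λ z → All.lookup A⊆B , All.lookup B⊆A
... | no A⊈B | _ = no λ A≐B → A⊈B (All.tabulate (proj₁ (A≐B _)))
... | yes _ | no B⊈A = no λ A≐B → B⊈A (All.tabulate (proj₂ (A≐B _)))

fresh : ∀ xs → suc (max 0 xs) ∉ xs
fresh xs z∈xs = 1+n≰n (All.lookup (xs≤max 0 xs) z∈xs)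

some-member : ∀ {Γ : Collection} → Γ ≢ [] → ∃[ A ] A ∈ Γ
some-member {[]} Γ≢[] = ⊥-elim (Γ≢[] refl)
some-member {A ∷ _} _ = A , here refl

module Maximal {F : Collection} (maximal : MaximalHKE F) where

  F≢[] : F ≢ []
  F≢[] = proj₁ (proj₁ maximal)

  α : ℕ
  α = proj₁ (proj₂ (proj₁ maximal))

  1≤α : 1 ≤ α
  1≤α = proj₁ (proj₂ (proj₂ (proj₁ maximal)))

  hke : HKEWith α F
  hke = proj₂ (proj₂ (proj₂ (proj₁ maximal)))

  extension-member : ∀ {B} → HKEWith α (B ∷ F) → ∃[ D ] D ∈ F × D ≐ B
  extension-member {B} hke⁺ with any? (_≐? B) F
  ... | yes some≐B = find some≐B
  ... | no none≐B = ⊥-elim (proj₂ maximal (B ∷ F) ((λ ()) , α , 1≤α , hke⁺)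
                              ((λ A A∈F → A , there A∈F , ≐-refl) , B , here refl , λ A A∈F A≐B → none≐B (lose A∈F A≐B)))

  exchange-member : ∀ {u v A} → All (Separates u v) F → A ∈ F → u ∈ A → ∃[ D ] D ∈ F × D ≐ exchange u v A
  exchange-member sepF A∈F u∈A = extension-member (exchange-extends {α} hke sepF A∈F u∈A)

  -- Were x in every member, x and a fresh element would be separated by F,
  -- and exchanging them in any member would give a set outside F.
  ⋂-empty : ∀ x → x ∉ ⋂ F
  ⋂-empty x x∈⋂F =
    let D , D∈F , D≐exchange = exchange-member sepF A∈F (All.lookup x∈all A∈F)
    in x∉exchange (proj₁ (D≐exchange x) (All.lookup x∈all D∈F))
    where
    x∈all : All (x ∈_) F
    x∈all = ∈-⋂⁻ F x∈⋂F
    A : FSet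
    A = proj₁ (some-member F≢[])
    A∈F : A ∈ F
    A∈F = proj₂ (some-member F≢[])
    z : ℕ
    z = suc (max 0 (⋃ F))
    sepF : All (Separates x z) F
    sepF = All.tabulate λ C∈F → inj₁ (All.lookup x∈all C∈F) , λ (_ , z∈C) → fresh (⋃ F) (∈-⋃⁺ C∈F z∈C)
    x∉exchange : x ∉ exchange x z A
    x∉exchange (here x≡z) = fresh (⋃ F) (subst (_∈ ⋃ F) x≡z (∈-⋃⁺ A∈F (All.lookup x∈all A∈F)))
    x∉exchange (there x∈A∖x) = proj₂ (∈-∖⁻ A x∈A∖x) refl

  separated-partner : ∀ {x} → x ∈ ⋃ F → ∃[ x' ] x' ∈ ⋃ F × All (Separates x x') F
  separated-partner x∈⋃F =
    let x' , x'∈⋃F , opposite = partner {α} hke F≢[] ⋂-empty x∈⋃F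
    in x' , x'∈⋃F , oppositeSides⇒separates opposite

  everyMeets⇒noneContains : ∀ {x y} → EveryMeets F x y → NoneContains F x y
  everyMeets⇒noneContains {x} {y} meets S₀ S₀∈F (x∈S₀ , y∈S₀) =
    let x' , x'∈⋃F , x∣x' = separated-partner (∈-⋃⁺ S₀∈F x∈S₀)
        y' , _ , y∣y' = separated-partner (∈-⋃⁺ S₀∈F y∈S₀)
        A , A∈F , x'∈A = ∈-⋃⁻ F x'∈⋃F
        y∈A = ∈-other (meets A A∈F) λ x∈A → separates-∈ (All.lookup x∣x' A∈F) x∈A x'∈A
        D , D∈F , D≐exchange = exchange-member y∣y' A∈F y∈A
        x'≢y = λ x'≡y → separates-∈ (All.lookup x∣x' S₀∈F) x∈S₀ (subst (_∈ S₀) (sym x'≡y) y∈S₀)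
        x'∈D = proj₂ (D≐exchange x') (there (∈-∖⁺ x'∈A x'≢y))
        y'∈D = proj₂ (D≐exchange y') (here refl)
    in [ (λ x∈D → separates-∈ (All.lookup x∣x' D∈F) x∈D x'∈D)
       , (λ y∈D → separates-∈ (All.lookup y∣y' D∈F) y∈D y'∈D) ]′ (meets D D∈F)

  noneContains⇒everyMeets : ∀ {x y} → x ∈ ⋃ F → y ∈ ⋃ F → NoneContains F x y → EveryMeets F x y
  noneContains⇒everyMeets {x} {y} x∈⋃F y∈⋃F none S S∈F with x ∈? S | y ∈? S
  ... | yes x∈S | _ = inj₁ x∈S
  ... | no _ | yes y∈S = inj₂ y∈S
  ... | no x∉S | no y∉S =
    let y' , _ , y∣y' = separated-partner y∈⋃F
        A , A∈F , x∈A = ∈-⋃⁻ F x∈⋃F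
        y'∈A = ∈-other (proj₁ (All.lookup y∣y' A∈F)) λ y∈A → none A A∈F (x∈A , y∈A)
        D , D∈F , D≐exchange = exchange-member (All.map separates-sym y∣y') A∈F y'∈A
        x≢y' = λ x≡y' → x∉S (subst (_∈ S) (sym x≡y') (∈-other (proj₁ (All.lookup y∣y' S∈F)) y∉S))
    in ⊥-elim (none D D∈F (proj₂ (D≐exchange x) (there (∈-∖⁺ x∈A x≢y')) , proj₂ (D≐exchange y) (here refl)))

  everyMeets⇒separates : ∀ {x y} → EveryMeets F x y → All (Separates x y) F
  everyMeets⇒separates meets = All.tabulate λ {S} S∈F → meets S S∈F , everyMeets⇒noneContains meets S S∈F

  everyMeets⇒≈ : ∀ {x y} → x ∈ ⋃ F → EveryMeets F x y → x ≈⟨ F ⟩ y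
  everyMeets⇒≈ {x} {y} x∈⋃F meets with ∈-⋃⁻ F x∈⋃F
  ... | A , A∈F , x∈A with exchange-member (everyMeets⇒separates meets) A∈F x∈A
  ... | D , D∈F , D≐exchange = inj₂ (A , D , A∈F , D∈F , A∖D≡x , D∖A≡y)
    where
    y∉A : y ∉ A
    y∉A = separates-∈ (All.lookup (everyMeets⇒separates meets) A∈F) x∈A
    x∉D : x ∉ D
    x∉D x∈D with proj₁ (D≐exchange x) x∈D
    ... | here refl = y∉A x∈A
    ... | there x∈A∖x = proj₂ (∈-∖⁻ A x∈A∖x) refl
    A∖D≡x : DiffIsSingleton A D x
    A∖D≡x z = (λ (z∈A , z∉D) → decide z∈A z∉D (z ≟ x)) , λ { refl → x∈A , x∉D }
      where
      decide : z ∈ A → z ∉ D → Dec (z ≡ x) → z ≡ x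
      decide _ _ (yes z≡x) = z≡x
      decide z∈A z∉D (no z≢x) = ⊥-elim (z∉D (proj₂ (D≐exchange z) (there (∈-∖⁺ z∈A z≢x))))
    D∖A≡y : DiffIsSingleton D A y
    D∖A≡y z = (λ (z∈D , z∉A) → from-exchange (proj₁ (D≐exchange z) z∈D) z∉A) , λ { refl → proj₂ (D≐exchange y) (here refl) , y∉A }
      where
      from-exchange : z ∈ exchange x y A → z ∉ A → z ≡ y
      from-exchange (here z≡y) _ = z≡y
      from-exchange (there z∈A∖x) z∉A = ⊥-elim (z∉A (proj₁ (∈-∖⁻ A z∈A∖x)))

mainTheorem17 : (F : Collection) → MaximalHKE F → (x y : ℕ) → x ∈ ⋃ F → y ∈ ⋃ F → ¬ (x ≡ y) →
    ((x ≈⟨ F ⟩ y → (∀ S → S ∈ F → x ∈ S ⊎ y ∈ S)) × ((∀ S → S ∈ F → x ∈ S ⊎ y ∈ S) → x ≈⟨ F ⟩ y))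
    × (((∀ S → S ∈ F → x ∈ S ⊎ y ∈ S) → (∀ S → S ∈ F → ¬ (x ∈ S × y ∈ S)))
       × ((∀ S → S ∈ F → ¬ (x ∈ S × y ∈ S)) → (∀ S → S ∈ F → x ∈ S ⊎ y ∈ S)))
mainTheorem17 F maximal x y x∈⋃F y∈⋃F x≢y =
  (≈⇒everyMeets {α} hke x≢y , everyMeets⇒≈ x∈⋃F) ,
  (everyMeets⇒noneContains , noneContains⇒everyMeets x∈⋃F y∈⋃F)
  where open Maximal maximal
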